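{- Let $n$ be an even positive integer, $d$ a divisor of $n$, $n_1=n/2$, and $0\le j\le n-1$ an even integer. Then: (1) if $n/d$ is odd, $c(j,n/d)=c\!\left(j/2,\tfrac{n_1}{d/2}\right)$; (2) if $n/d\equiv 2\pmod 4$, $c(j,n/d)=c(j/2,n_1/d)$; (3) if $4\mid n/d$, $c(j,n/d)=2c(j/2,n_1/d)$.
   Context: The Ramanujan function is $c(j,m)=\mu(t_{m,j})\,\varphi(m)/\varphi(t_{m,j})$ with $t_{m,j}=m/\gcd(m,j)$ ($\gcd(m,0)=m$), where $\mu$ is the Möbius function and $\varphi$ Euler's totient function. -}

module Defs where

open import Data.Nat using (ℕ; zero; suc; _*_; _≤_; _∸_)
open import Data.Nat.DivMod using (_/_)
open import Data.Nat.GCD using (gcd)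
open import Data.Nat.Divisibility using (_∣_; _∣?_)
open import Data.Nat.Primality using (Prime; prime?)
open import Data.List using (List; length; filter; upTo; map)
open import Data.Bool.ListAction using (any)
open import Data.Integer using (ℤ; +_; -_; _*_)
open import Data.Bool using (Bool; true; false; if_then_else_)
open import Relation.Nullary.Decidable using (⌊_⌋)
open import Data.Product using (_×_; _,_)
open import Relation.Nullary.Decidable using (_×-dec_)

-- Total natural-number division: a div b = ⌊a/b⌋ for b ≠ 0, and 0 for b = 0.
-- (Only ever used with nonzero divisors in the statement.)
_div_ : ℕ → ℕ → ℕ
a div zero = 0
a div suc k = a / suc k

φ : ℕ → ℕ
φ m = length (filter (λ k → gcd (suc k) m Data.Nat.≟ 1) (upTo m))

primeDivisors : ℕ → List ℕ
primeDivisors m = filter (λ p → prime? p ×-dec (p ∣? m)) (upTo (suc m))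

hasSquarePrimeFactor : ℕ → Bool
hasSquarePrimeFactor m = any (λ p → ⌊ (p Data.Nat.* p) ∣? m ⌋) (primeDivisors m)

negOnePow : ℕ → ℤ
negOnePow zero = + 1
negOnePow (suc r) = - negOnePow r

μ : ℕ → ℤ
μ zero = + 0
μ m@(suc _) = if hasSquarePrimeFactor m then + 0 else negOnePow (length (primeDivisors m))

t : ℕ → ℕ → ℕ
t m j = m div gcd m j

c : ℕ → ℕ → ℤ
c j m = μ (t m j) Data.Integer.* (+ (φ m div φ (t m j)))

-- Write j = 2b and q = n/d. For odd q, gcd(q, 2b) = gcd(q, b), so nothing changes. For q = 2h one has
-- t_{2h,2b} = t_{h,b}, so c(2b, 2h) and c(b, h) differ only in φ(2h) versus φ(h): these are equal for h odd
-- and φ(2h) = 2φ(h) for h even, and the factor 2 leaves the quotient by φ(t) because φ(t) ∣ φ(h) when t ∣ h.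
-- The totient identities come from counting residues coprime to m in blocks of length m, and φ(t) ∣ φ(h)
-- from φ(m) ∣ φ(pm) for every prime p, applied along the prime factorisation of h/t.
module Submission where

module Totient where

  open import Data.Bool.Base using (Bool; true; false; _∧_; not)
  open import Data.Bool.Properties using (∧-identityʳ; ∧-zeroʳ)
  open import Data.List.Base using (length; filter; applyUpTo; _∷_)
  open import Data.List.Relation.Unary.All using (All; []; _∷_)
  open import Data.Nat.Base
  open import Data.Nat.Coprimality as Coprime using (Coprime; coprime?; coprime-divisor)
  open import Data.Nat.Divisibility
  open import Data.Nat.GCD using (gcd)
  open import Data.Nat.ListAction using (product)
  open import Data.Nat.Primality using (Prime; prime⇒irreducible; prime⇒nonZero; prime⇒nonTrivial)
  open import Data.Nat.Primality.Factorisation using (factorise; PrimeFactorisation)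
  open import Data.Nat.Properties
  open import Algebra.Properties.CommutativeSemigroup +-commutativeSemigroup using (interchange)
  open import Data.Product.Base using (_×_; _,_)
  open import Data.Sum.Base using (inj₁; inj₂)
  open import Function.Base using (_∘_; id)
  open import Function.Bundles using (_⇔_; mk⇔)
  open import Relation.Binary.PropositionalEquality
  open import Relation.Nullary.Decidable using (yes; no; does; ¬?; _×-dec_; does-⇔; dec-true; dec-false)
  open import Relation.Nullary.Negation using (¬_; contradiction)
  open import Relation.Unary using (Pred; Decidable)

  open import Defs

  private
    variable
      a b k m n p : ℕ

  bit : Bool → ℕ
  bit true  = 1
  bit false = 0

  count : (ℕ → Bool) → ℕ → ℕ
  count f zero    = 0
  count f (suc n) = bit (f 0) + count (f ∘ suc) n

  length-filter-applyUpTo : ∀ {ℓ} {P : Pred ℕ ℓ} (P? : Decidable P) g n →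
                            length (filter P? (applyUpTo g n)) ≡ count (does ∘ P? ∘ g) n
  length-filter-applyUpTo P? g zero = refl
  length-filter-applyUpTo P? g (suc n) with does (P? (g 0))
  ... | true  = cong suc (length-filter-applyUpTo P? (g ∘ suc) n)
  ... | false = length-filter-applyUpTo P? (g ∘ suc) n

  count-cong : ∀ {f g : ℕ → Bool} → (∀ k → f k ≡ g k) → ∀ n → count f n ≡ count g n
  count-cong f≗g zero    = refl
  count-cong f≗g (suc n) = cong₂ _+_ (cong bit (f≗g 0)) (count-cong (f≗g ∘ suc) n)

  count-+ : ∀ (f : ℕ → Bool) m n → count f (m + n) ≡ count f m + count (λ k → f (m + k)) n
  count-+ f zero    n = refl
  count-+ f (suc m) n = trans (cong (bit (f 0) +_) (count-+ (f ∘ suc) m n)) (sym (+-assoc (bit (f 0)) _ _))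

  count-periodic : ∀ (f : ℕ → Bool) m → (∀ k → f (m + k) ≡ f k) → ∀ q → count f (q * m) ≡ q * count f m
  count-periodic f m periodic zero    = refl
  count-periodic f m periodic (suc q) = begin
    count f (m + q * m)                           ≡⟨ count-+ f m (q * m) ⟩
    count f m + count (λ k → f (m + k)) (q * m)   ≡⟨ cong (count f m +_) (count-cong periodic (q * m)) ⟩
    count f m + count f (q * m)                   ≡⟨ cong (count f m +_) (count-periodic f m periodic q) ⟩
    count f m + q * count f m                     ∎
    where open ≡-Reasoning

  count-∘suc : ∀ (f : ℕ → Bool) n → f n ≡ f 0 → count (f ∘ suc) n ≡ count f n
  count-∘suc f n fn≡f0 = +-cancelˡ-≡ (bit (f 0)) _ _ (begin
    count f (1 + n)                     ≡⟨ cong (count f) (+-comm 1 n) ⟩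
    count f (n + 1)                     ≡⟨ count-+ f n 1 ⟩
    count f n + (bit (f (n + 0)) + 0)   ≡⟨ cong (λ x → count f n + (bit (f x) + 0)) (+-identityʳ n) ⟩
    count f n + (bit (f n) + 0)         ≡⟨ cong (λ b → count f n + (bit b + 0)) fn≡f0 ⟩
    count f n + (bit (f 0) + 0)         ≡⟨ cong (count f n +_) (+-identityʳ _) ⟩
    count f n + bit (f 0)               ≡⟨ +-comm (count f n) _ ⟩
    bit (f 0) + count f n               ∎)
    where open ≡-Reasoning

  bit[x∧y]+bit[x∧¬y]≡bit[x] : ∀ x y → bit (x ∧ y) + bit (x ∧ not y) ≡ bit x
  bit[x∧y]+bit[x∧¬y]≡bit[x] true  true  = refl
  bit[x∧y]+bit[x∧¬y]≡bit[x] true  false = refl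
  bit[x∧y]+bit[x∧¬y]≡bit[x] false y     = refl

  count-∧-split : ∀ (f g : ℕ → Bool) n →
                  count (λ k → f k ∧ g k) n + count (λ k → f k ∧ not (g k)) n ≡ count f n
  count-∧-split f g zero    = refl
  count-∧-split f g (suc n) = trans
    (interchange (bit (f 0 ∧ g 0)) _ (bit (f 0 ∧ not (g 0))) _)
    (cong₂ _+_ (bit[x∧y]+bit[x∧¬y]≡bit[x] (f 0) (g 0)) (count-∧-split (f ∘ suc) (g ∘ suc) n))

  count-false : ∀ (f : ℕ → Bool) n → (∀ k → k < n → f k ≡ false) → count f n ≡ 0
  count-false f zero    _      = refl
  count-false f (suc n) f≡false rewrite f≡false 0 z<s =
    count-false (f ∘ suc) n (λ k k<n → f≡false (suc k) (s<s k<n))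

  count-∧-∣-block : ∀ p .{{_ : NonZero p}} (f : ℕ → Bool) →
                    count (λ k → f k ∧ does (p ∣? k)) p ≡ bit (f 0)
  count-∧-∣-block (suc p) f = begin
    bit (f 0 ∧ does (suc p ∣? 0)) + count (λ k → f (suc k) ∧ does (suc p ∣? suc k)) p
      ≡⟨ cong₂ _+_ (cong (λ b → bit (f 0 ∧ b)) (dec-true (suc p ∣? 0) (suc p ∣0)))
                   (count-false _ p nonMultiple) ⟩
    bit (f 0 ∧ true) + 0   ≡⟨ +-identityʳ _ ⟩
    bit (f 0 ∧ true)       ≡⟨ cong bit (∧-identityʳ (f 0)) ⟩
    bit (f 0)              ∎
    where
    open ≡-Reasoning
    nonMultiple : ∀ k → k < p → f (suc k) ∧ does (suc p ∣? suc k) ≡ false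
    nonMultiple k k<p rewrite dec-false (suc p ∣? suc k) (>⇒∤ (s<s k<p)) = ∧-zeroʳ (f (suc k))

  count-∧-∣ : ∀ p .{{_ : NonZero p}} (f : ℕ → Bool) m →
              count (λ k → f k ∧ does (p ∣? k)) (m * p) ≡ count (λ i → f (i * p)) m
  count-∧-∣ p f zero    = refl
  count-∧-∣ p f (suc m) = begin
    count F (p + m * p)                                           ≡⟨ count-+ F p (m * p) ⟩
    count F p + count (λ k → F (p + k)) (m * p)
      ≡⟨ cong₂ _+_ (count-∧-∣-block p f) (count-cong shift (m * p)) ⟩
    bit (f 0) + count (λ k → f (p + k) ∧ does (p ∣? k)) (m * p)
      ≡⟨ cong (bit (f 0) +_) (count-∧-∣ p (λ k → f (p + k)) m) ⟩
    bit (f 0) + count (λ i → f (p + i * p)) m                     ∎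
    where
    open ≡-Reasoning
    F : ℕ → Bool
    F k = f k ∧ does (p ∣? k)
    shift : ∀ k → F (p + k) ≡ f (p + k) ∧ does (p ∣? k)
    shift k = cong (f (p + k) ∧_)
      (does-⇔ (mk⇔ (λ p∣p+k → ∣m+n∣m⇒∣n p∣p+k ∣-refl) (∣m∣n⇒∣m+n ∣-refl)) (p ∣? (p + k)) (p ∣? k))

  coprime-∣ʳ : Coprime a b → k ∣ b → Coprime a k
  coprime-∣ʳ a⊥b k∣b (d∣a , d∣k) = a⊥b (d∣a , ∣-trans d∣k k∣b)

  coprime-*ʳ : Coprime a b → Coprime a k → Coprime a (b * k)
  coprime-*ʳ a⊥b a⊥k (d∣a , d∣b*k) =
    a⊥k (d∣a , coprime-divisor (Coprime.sym (coprime-∣ʳ (Coprime.sym a⊥b) d∣a)) d∣b*k)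

  ∤-prime⇒coprime : Prime p → ¬ p ∣ a → Coprime a p
  ∤-prime⇒coprime p-prime p∤a {d} (d∣a , d∣p) with prime⇒irreducible p-prime d∣p
  ... | inj₁ d≡1  = d≡1
  ... | inj₂ refl = contradiction d∣a p∤a

  coprime[k,p*m]⇔coprime[k,m]×p∤k : Prime p → Coprime k (p * m) ⇔ (Coprime k m × ¬ p ∣ k)
  coprime[k,p*m]⇔coprime[k,m]×p∤k {p = p} {k = k} {m = m} p-prime = mk⇔ to from
    where
    to : Coprime k (p * m) → Coprime k m × ¬ p ∣ k
    to k⊥pm = coprime-∣ʳ k⊥pm (n∣m*n p) ,
              λ p∣k → nonTrivial⇒≢1 {{prime⇒nonTrivial p-prime}} (k⊥pm (p∣k , m∣m*n m))
    from : Coprime k m × ¬ p ∣ k → Coprime k (p * m)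
    from (k⊥m , p∤k) = coprime-*ʳ (∤-prime⇒coprime p-prime p∤k) k⊥m

  coprime[m+k,m]⇔coprime[k,m] : Coprime (m + k) m ⇔ Coprime k m
  coprime[m+k,m]⇔coprime[k,m] {m = m} {k = k} = mk⇔ to Coprime.coprime-+
    where
    to : Coprime (m + k) m → Coprime k m
    to m+k⊥m (d∣k , d∣m) = m+k⊥m (∣m∣n⇒∣m+n d∣m d∣k , d∣m)

  coprime[k,p*m]⇔coprime[k,m] : p ∣ m → Coprime k (p * m) ⇔ Coprime k m
  coprime[k,p*m]⇔coprime[k,m] {p = p} {m = m} {k = k} p∣m = mk⇔ to from
    where
    to : Coprime k (p * m) → Coprime k m
    to k⊥pm = coprime-∣ʳ k⊥pm (n∣m*n p)
    from : Coprime k m → Coprime k (p * m)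
    from k⊥m = coprime-*ʳ (coprime-∣ʳ k⊥m p∣m) k⊥m

  coprime[k*p,m]⇔coprime[k,m] : Prime p → ¬ p ∣ m → Coprime (k * p) m ⇔ Coprime k m
  coprime[k*p,m]⇔coprime[k,m] {p = p} {m = m} {k = k} p-prime p∤m = mk⇔ to from
    where
    to : Coprime (k * p) m → Coprime k m
    to kp⊥m = Coprime.sym (coprime-∣ʳ (Coprime.sym kp⊥m) (m∣m*n p))
    from : Coprime k m → Coprime (k * p) m
    from k⊥m = Coprime.sym (coprime-*ʳ (Coprime.sym k⊥m) (∤-prime⇒coprime p-prime p∤m))

  coprimeTo : ℕ → ℕ → Bool
  coprimeTo m k = does (coprime? k m)

  coprimeTo-periodic : ∀ m k → coprimeTo m (m + k) ≡ coprimeTo m k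
  coprimeTo-periodic m k = does-⇔ coprime[m+k,m]⇔coprime[k,m] (coprime? (m + k) m) (coprime? k m)

  φ≡count-coprimeTo : ∀ m → φ m ≡ count (coprimeTo m) m
  φ≡count-coprimeTo m = begin
    φ m                                        ≡⟨ length-filter-applyUpTo (λ k → gcd (suc k) m ≟ 1) id m ⟩
    count (λ k → does (gcd (suc k) m ≟ 1)) m   ≡⟨ count-cong gcd≡1≗coprimeTo m ⟩
    count (coprimeTo m ∘ suc) m                ≡⟨ count-∘suc (coprimeTo m) m coprimeTo[m,m] ⟩
    count (coprimeTo m) m                      ∎
    where
    open ≡-Reasoning
    gcd≡1≗coprimeTo : ∀ k → does (gcd (suc k) m ≟ 1) ≡ coprimeTo m (suc k)
    gcd≡1≗coprimeTo k = does-⇔ (mk⇔ Coprime.gcd≡1⇒coprime Coprime.coprime⇒gcd≡1)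
      (gcd (suc k) m ≟ 1) (coprime? (suc k) m)
    coprimeTo[m,m] : coprimeTo m m ≡ coprimeTo m 0
    coprimeTo[m,m] = trans (cong (coprimeTo m) (sym (+-identityʳ m))) (coprimeTo-periodic m 0)

  count-coprimeTo : ∀ q m → count (coprimeTo m) (q * m) ≡ q * φ m
  count-coprimeTo q m = trans (count-periodic (coprimeTo m) m (coprimeTo-periodic m) q)
                              (cong (q *_) (sym (φ≡count-coprimeTo m)))

  φ[p*m]≡p*φ[m] : p ∣ m → φ (p * m) ≡ p * φ m
  φ[p*m]≡p*φ[m] {p} {m} p∣m = begin
    φ (p * m)                          ≡⟨ φ≡count-coprimeTo (p * m) ⟩
    count (coprimeTo (p * m)) (p * m)  ≡⟨ count-cong coprimeTo[p*m]≗coprimeTo[m] (p * m) ⟩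
    count (coprimeTo m) (p * m)        ≡⟨ count-coprimeTo p m ⟩
    p * φ m                            ∎
    where
    open ≡-Reasoning
    coprimeTo[p*m]≗coprimeTo[m] : ∀ k → coprimeTo (p * m) k ≡ coprimeTo m k
    coprimeTo[p*m]≗coprimeTo[m] k =
      does-⇔ (coprime[k,p*m]⇔coprime[k,m] p∣m) (coprime? k (p * m)) (coprime? k m)

  -- Among the k < p m coprime to m, the non-multiples of p are those coprime to p m,
  -- and the multiples k = i p correspond to the i < m coprime to m, because p ∤ m.
  φ[m]+φ[p*m]≡p*φ[m] : Prime p → ¬ p ∣ m → φ m + φ (p * m) ≡ p * φ m
  φ[m]+φ[p*m]≡p*φ[m] {p} {m} p-prime p∤m = begin
    φ m + φ (p * m)
      ≡⟨ cong₂ _+_ φ[m]≡multiples φ[p*m]≡nonMultiples ⟩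
    count (λ k → coprimeTo m k ∧ does (p ∣? k)) (p * m) + count (λ k → coprimeTo m k ∧ not (does (p ∣? k))) (p * m)
      ≡⟨ count-∧-split (coprimeTo m) (λ k → does (p ∣? k)) (p * m) ⟩
    count (coprimeTo m) (p * m)
      ≡⟨ count-coprimeTo p m ⟩
    p * φ m
      ∎
    where
    open ≡-Reasoning
    instance _ = prime⇒nonZero p-prime
    φ[p*m]≡nonMultiples : φ (p * m) ≡ count (λ k → coprimeTo m k ∧ not (does (p ∣? k))) (p * m)
    φ[p*m]≡nonMultiples = trans (φ≡count-coprimeTo (p * m)) (count-cong coprimeTo[p*m]≗coprimeTo[m]∧¬p∣ (p * m))
      where
      coprimeTo[p*m]≗coprimeTo[m]∧¬p∣ : ∀ k → coprimeTo (p * m) k ≡ coprimeTo m k ∧ not (does (p ∣? k))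
      coprimeTo[p*m]≗coprimeTo[m]∧¬p∣ k = does-⇔ (coprime[k,p*m]⇔coprime[k,m]×p∤k p-prime)
        (coprime? k (p * m)) (coprime? k m ×-dec ¬? (p ∣? k))
    coprimeTo[i]≗coprimeTo[i*p] : ∀ i → coprimeTo m i ≡ coprimeTo m (i * p)
    coprimeTo[i]≗coprimeTo[i*p] i =
      sym (does-⇔ (coprime[k*p,m]⇔coprime[k,m] p-prime p∤m) (coprime? (i * p) m) (coprime? i m))
    φ[m]≡multiples : φ m ≡ count (λ k → coprimeTo m k ∧ does (p ∣? k)) (p * m)
    φ[m]≡multiples = begin
      φ m                                                    ≡⟨ φ≡count-coprimeTo m ⟩
      count (coprimeTo m) m                                  ≡⟨ count-cong coprimeTo[i]≗coprimeTo[i*p] m ⟩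
      count (λ i → coprimeTo m (i * p)) m                    ≡⟨ count-∧-∣ p (coprimeTo m) m ⟨
      count (λ k → coprimeTo m k ∧ does (p ∣? k)) (m * p)    ≡⟨ cong (count _) (*-comm m p) ⟩
      count (λ k → coprimeTo m k ∧ does (p ∣? k)) (p * m)    ∎

  φ∣φ[p*m] : Prime p → φ m ∣ φ (p * m)
  φ∣φ[p*m] {p} {m} p-prime with p ∣? m
  ... | yes p∣m = subst (φ m ∣_) (sym (φ[p*m]≡p*φ[m] p∣m)) (n∣m*n p)
  ... | no  p∤m = ∣m+n∣m⇒∣n (subst (φ m ∣_) (sym (φ[m]+φ[p*m]≡p*φ[m] p-prime p∤m)) (n∣m*n p)) ∣-refl

  φ∣φ[product*m] : ∀ {ps} → All Prime ps → ∀ m → φ m ∣ φ (product ps * m)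
  φ∣φ[product*m] []                      m = subst (λ x → φ m ∣ φ x) (sym (+-identityʳ m)) ∣-refl
  φ∣φ[product*m] {p ∷ ps} (p-prime ∷ primes) m = ∣-trans (φ∣φ[product*m] primes m)
    (subst (λ x → φ (product ps * m) ∣ φ x) (sym (*-assoc p (product ps) m)) (φ∣φ[p*m] p-prime))

  φ-mono-∣ : .{{NonZero n}} → m ∣ n → φ m ∣ φ n
  φ-mono-∣ {m = m} (divides k refl) =
    subst (λ x → φ m ∣ φ (x * m)) (sym isFactorisation) (φ∣φ[product*m] factorsPrime m)
    where
    instance _ = m*n≢0⇒m≢0 k
    open PrimeFactorisation (factorise k)

module Ramanujan where

  open import Data.Integer.Base as ℤ using (ℤ)
  import Data.Integer.Properties as ℤ
  open import Algebra.Properties.CommutativeSemigroup ℤ.*-commutativeSemigroup using (x∙yz≈y∙xz)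
  open import Data.Nat.Base
  open import Data.Nat.Properties
  open import Data.Nat.Coprimality as Coprime using (Coprime; coprime-divisor)
  open import Data.Nat.Divisibility
  open import Data.Nat.DivMod using (m≡m%n+[m/n]*n; m*n/n≡m; m*n/o*n≡m/o; m/n/o≡m/[n*o]; *-/-assoc)
  open import Data.Nat.GCD using (gcd; gcd[m,n]∣m; gcd[m,n]∣n; gcd-greatest; c*gcd[m,n]≡gcd[cm,cn])
  open import Data.Nat.Primality using (prime[2])
  open import Data.Product.Base using (∃; _×_; _,_)
  open import Relation.Binary.PropositionalEquality
  open import Relation.Nullary.Negation using (¬_)
  open import Defs
  open Totient using (coprime-∣ʳ; ∤-prime⇒coprime; φ[p*m]≡p*φ[m]; φ[m]+φ[p*m]≡p*φ[m]; φ-mono-∣)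

  private
    variable
      j k m n : ℕ

  m-div-n≡m/n : ∀ m n .{{_ : NonZero n}} → m div n ≡ m / n
  m-div-n≡m/n m (suc n) = refl

  m*n-div-n≡m : ∀ m n .{{_ : NonZero n}} → (m * n) div n ≡ m
  m*n-div-n≡m m n = trans (m-div-n≡m/n (m * n) n) (m*n/n≡m m n)

  m*k-div-n*k≡m-div-n : ∀ m n k .{{_ : NonZero k}} → (m * k) div (n * k) ≡ m div n
  m*k-div-n*k≡m-div-n m zero    k = refl
  m*k-div-n*k≡m-div-n m (suc n) k = trans (m-div-n≡m/n (m * k) (suc n * k)) (m*n/o*n≡m/o m k (suc n))
    where instance _ = m*n≢0 (suc n) k

  m*n-div-o≡m*[n-div-o] : ∀ m {n o} → o ∣ n → (m * n) div o ≡ m * (n div o)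
  m*n-div-o≡m*[n-div-o] m {o = zero}  _   = sym (*-zeroʳ m)
  m*n-div-o≡m*[n-div-o] m {o = suc o} o∣n = *-/-assoc m o∣n

  0-div-n≡0 : ∀ n → 0 div n ≡ 0
  0-div-n≡0 zero    = refl
  0-div-n≡0 (suc n) = refl

  m-div-n-div-o≡m-div-[n*o] : ∀ m n o → (m div n) div o ≡ m div (n * o)
  m-div-n-div-o≡m-div-[n*o] m zero    o       = 0-div-n≡0 o
  m-div-n-div-o≡m-div-[n*o] m (suc n) zero    = sym (cong (m div_) (*-zeroʳ (suc n)))
  m-div-n-div-o≡m-div-[n*o] m (suc n) (suc o) = begin
    (m div suc n) div suc o   ≡⟨ cong (_div suc o) (m-div-n≡m/n m (suc n)) ⟩
    m / suc n / suc o         ≡⟨ m/n/o≡m/[n*o] m (suc n) (suc o) ⟩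
    m / (suc n * suc o)       ≡⟨ m-div-n≡m/n m (suc n * suc o) ⟨
    m div (suc n * suc o)     ∎
    where open ≡-Reasoning

  m-div-n-div-o≡m-div-o-div-n : ∀ m n o → (m div n) div o ≡ (m div o) div n
  m-div-n-div-o≡m-div-o-div-n m n o = begin
    (m div n) div o   ≡⟨ m-div-n-div-o≡m-div-[n*o] m n o ⟩
    m div (n * o)     ≡⟨ cong (m div_) (*-comm n o) ⟩
    m div (o * n)     ≡⟨ m-div-n-div-o≡m-div-[n*o] m o n ⟨
    (m div o) div n   ∎
    where open ≡-Reasoning

  m-div-k-div-[n-div-k]≡m-div-n : ∀ m {n k} → k ∣ n → (m div k) div (n div k) ≡ m div n
  m-div-k-div-[n-div-k]≡m-div-n m {k = zero}  (divides r refl) = sym (cong (m div_) (*-zeroʳ r))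
  m-div-k-div-[n-div-k]≡m-div-n m {k = suc k} (divides r refl) = begin
    (m div suc k) div ((r * suc k) div suc k)   ≡⟨ cong ((m div suc k) div_) (m*n-div-n≡m r (suc k)) ⟩
    (m div suc k) div r                         ≡⟨ m-div-n-div-o≡m-div-o-div-n m (suc k) r ⟩
    (m div r) div suc k                         ≡⟨ m-div-n-div-o≡m-div-[n*o] m r (suc k) ⟩
    m div (r * suc k)                           ∎
    where open ≡-Reasoning

  m-div-n*n≡m : n ∣ m → (m div n) * n ≡ m
  m-div-n*n≡m {zero}  (divides q refl) = sym (*-zeroʳ q)
  m-div-n*n≡m {suc n} (divides q refl) = cong (_* suc n) (m*n-div-n≡m q (suc n))

  gcd[m,n*k]≡gcd[m,n] : Coprime m k → gcd m (n * k) ≡ gcd m n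
  gcd[m,n*k]≡gcd[m,n] {m} {k} {n} m⊥k = ∣-antisym
    (gcd-greatest (gcd[m,n]∣m m (n * k))
                  (coprime-divisor g⊥k (subst (g ∣_) (*-comm n k) (gcd[m,n]∣n m (n * k)))))
    (gcd-greatest (gcd[m,n]∣m m n) (∣m⇒∣m*n k (gcd[m,n]∣n m n)))
    where
    g : ℕ
    g = gcd m (n * k)
    g⊥k : Coprime g k
    g⊥k = Coprime.sym (coprime-∣ʳ (Coprime.sym m⊥k) (gcd[m,n]∣m m (n * k)))

  gcd[m*k,n*k]≡gcd[m,n]*k : ∀ m n k → gcd (m * k) (n * k) ≡ gcd m n * k
  gcd[m*k,n*k]≡gcd[m,n]*k m n k = begin
    gcd (m * k) (n * k)   ≡⟨ cong₂ gcd (*-comm m k) (*-comm n k) ⟩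
    gcd (k * m) (k * n)   ≡⟨ c*gcd[m,n]≡gcd[cm,cn] k m n ⟨
    k * gcd m n           ≡⟨ *-comm k (gcd m n) ⟩
    gcd m n * k           ∎
    where open ≡-Reasoning

  t[m,j]∣m : ∀ m j → t m j ∣ m
  t[m,j]∣m m j with gcd m j | gcd[m,n]∣m m j
  ... | zero  | 0∣m = 0∣m
  ... | suc g | g∣m = m/n∣m g∣m

  t[m,j*k]≡t[m,j] : Coprime m k → t m (j * k) ≡ t m j
  t[m,j*k]≡t[m,j] {m} m⊥k = cong (m div_) (gcd[m,n*k]≡gcd[m,n] m⊥k)

  t[m*k,j*k]≡t[m,j] : ∀ m j k .{{_ : NonZero k}} → t (m * k) (j * k) ≡ t m j
  t[m*k,j*k]≡t[m,j] m j k =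
    trans (cong ((m * k) div_) (gcd[m*k,n*k]≡gcd[m,n]*k m j k)) (m*k-div-n*k≡m-div-n m (gcd m j) k)

  c[j*k,m]≡c[j,m] : Coprime m k → c (j * k) m ≡ c j m
  c[j*k,m]≡c[j,m] {m} m⊥k = cong (λ T → μ T ℤ.* ℤ.+ (φ m div φ T)) (t[m,j*k]≡t[m,j] m⊥k)

  c[j*k,m*k]≡μ[t]*φ[m*k]/φ[t] : ∀ j m k .{{_ : NonZero k}} →
                                 c (j * k) (m * k) ≡ μ (t m j) ℤ.* ℤ.+ (φ (m * k) div φ (t m j))
  c[j*k,m*k]≡μ[t]*φ[m*k]/φ[t] j m k =
    cong (λ T → μ T ℤ.* ℤ.+ (φ (m * k) div φ T)) (t[m*k,j*k]≡t[m,j] m j k)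

  c[j*2,m*2]≡c[j,m] : ¬ 2 ∣ m → c (j * 2) (m * 2) ≡ c j m
  c[j*2,m*2]≡c[j,m] {m} {j} 2∤m =
    trans (c[j*k,m*k]≡μ[t]*φ[m*k]/φ[t] j m 2)
          (cong (λ x → μ (t m j) ℤ.* ℤ.+ (x div φ (t m j))) φ[m*2]≡φ[m])
    where
    φ[m*2]≡φ[m] : φ (m * 2) ≡ φ m
    φ[m*2]≡φ[m] = begin
      φ (m * 2)   ≡⟨ cong φ (*-comm m 2) ⟩
      φ (2 * m)   ≡⟨ +-cancelˡ-≡ (φ m) _ _ (φ[m]+φ[p*m]≡p*φ[m] prime[2] 2∤m) ⟩
      φ m + 0     ≡⟨ +-identityʳ (φ m) ⟩
      φ m         ∎
      where open ≡-Reasoning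

  c[j,0]≡0 : ∀ j → c j 0 ≡ ℤ.+ 0
  c[j,0]≡0 j = cong (λ T → μ T ℤ.* ℤ.+ (φ 0 div φ T)) (0-div-n≡0 (gcd 0 j))

  c[j*2,m*2]≡2*c[j,m] : 2 ∣ m → c (j * 2) (m * 2) ≡ ℤ.+ 2 ℤ.* c j m
  c[j*2,m*2]≡2*c[j,m] {zero}      {j} _   = trans (c[j,0]≡0 (j * 2)) (sym (cong (ℤ.+ 2 ℤ.*_) (c[j,0]≡0 j)))
  c[j*2,m*2]≡2*c[j,m] {m@(suc _)} {j} 2∣m = begin
    c (j * 2) (m * 2)                       ≡⟨ c[j*k,m*k]≡μ[t]*φ[m*k]/φ[t] j m 2 ⟩
    μ T ℤ.* ℤ.+ (φ (m * 2) div φ T)         ≡⟨ cong (λ x → μ T ℤ.* ℤ.+ (x div φ T)) φ[m*2]≡2*φ[m] ⟩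
    μ T ℤ.* ℤ.+ ((2 * φ m) div φ T)         ≡⟨ cong (λ x → μ T ℤ.* ℤ.+ x) (m*n-div-o≡m*[n-div-o] 2 φ[T]∣φ[m]) ⟩
    μ T ℤ.* ℤ.+ (2 * (φ m div φ T))         ≡⟨ cong (μ T ℤ.*_) (ℤ.pos-* 2 (φ m div φ T)) ⟩
    μ T ℤ.* (ℤ.+ 2 ℤ.* ℤ.+ (φ m div φ T))   ≡⟨ x∙yz≈y∙xz (μ T) (ℤ.+ 2) _ ⟩
    ℤ.+ 2 ℤ.* c j m                         ∎
    where
    open ≡-Reasoning
    T : ℕ
    T = t m j
    φ[T]∣φ[m] : φ T ∣ φ m
    φ[T]∣φ[m] = φ-mono-∣ (t[m,j]∣m m j)
    φ[m*2]≡2*φ[m] : φ (m * 2) ≡ 2 * φ m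
    φ[m*2]≡2*φ[m] = trans (cong φ (*-comm m 2)) (φ[p*m]≡p*φ[m] 2∣m)

  ¬2∣1+k*2 : ∀ k → ¬ 2 ∣ suc (k * 2)
  ¬2∣1+k*2 k 2∣1+k*2 with ∣1⇒≡1 (∣m+n∣m⇒∣n (subst (2 ∣_) (+-comm 1 (k * 2)) 2∣1+k*2) (n∣m*n k))
  ... | ()

  m%2≡1⇒¬2∣m : ∀ m → m % 2 ≡ 1 → ¬ 2 ∣ m
  m%2≡1⇒¬2∣m m m%2≡1 2∣m = 0≢1+n (trans (sym (n∣m⇒m%n≡0 m 2 2∣m)) m%2≡1)

  m%4≡2⇒m≡odd*2 : ∀ m → m % 4 ≡ 2 → ∃ λ h → m ≡ h * 2 × ¬ 2 ∣ h
  m%4≡2⇒m≡odd*2 m m%4≡2 = suc (m / 4 * 2) , m≡[1+m/4*2]*2 , ¬2∣1+k*2 (m / 4)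
    where
    m≡[1+m/4*2]*2 : m ≡ suc (m / 4 * 2) * 2
    m≡[1+m/4*2]*2 = begin
      m                    ≡⟨ m≡m%n+[m/n]*n m 4 ⟩
      m % 4 + m / 4 * 4    ≡⟨ cong₂ _+_ m%4≡2 (sym (*-assoc (m / 4) 2 2)) ⟩
      2 + m / 4 * 2 * 2    ∎
      where open ≡-Reasoning

  4∣m⇒m≡even*2 : 4 ∣ m → ∃ λ h → m ≡ h * 2 × 2 ∣ h
  4∣m⇒m≡even*2 (divides r m≡r*4) = r * 2 , trans m≡r*4 (sym (*-assoc r 2 2)) , n∣m*n r

  c[j,q]≡c[j/2,q] : ∀ q → 2 ∣ j → q % 2 ≡ 1 → c j q ≡ c (j div 2) q
  c[j,q]≡c[j/2,q] q (divides b refl) q%2≡1 = trans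
    (c[j*k,m]≡c[j,m] (∤-prime⇒coprime prime[2] (m%2≡1⇒¬2∣m q q%2≡1)))
    (cong (λ i → c i q) (sym (m*n-div-n≡m b 2)))

  c[j,q]≡c[j/2,q/2] : ∀ q → 2 ∣ j → q % 4 ≡ 2 → c j q ≡ c (j div 2) (q div 2)
  c[j,q]≡c[j/2,q/2] q (divides b refl) q%4≡2 with m%4≡2⇒m≡odd*2 q q%4≡2
  ... | h , refl , 2∤h =
    trans (c[j*2,m*2]≡c[j,m] 2∤h) (sym (cong₂ c (m*n-div-n≡m b 2) (m*n-div-n≡m h 2)))

  c[j,q]≡2*c[j/2,q/2] : ∀ q → 2 ∣ j → 4 ∣ q → c j q ≡ ℤ.+ 2 ℤ.* c (j div 2) (q div 2)
  c[j,q]≡2*c[j/2,q/2] q (divides b refl) 4∣q with 4∣m⇒m≡even*2 4∣q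
  ... | h , refl , 2∣h = trans (c[j*2,m*2]≡2*c[j,m] 2∣h)
    (sym (cong₂ (λ i r → ℤ.+ 2 ℤ.* c i r) (m*n-div-n≡m b 2) (m*n-div-n≡m h 2)))

open import Data.Nat using (ℕ; _<_; _%_)
open import Data.Nat.Divisibility using (_∣_)
open import Data.Integer using (ℤ; +_; _*_)
open import Data.Product using (_×_; _,_)
open import Data.Sum using (inj₁; inj₂)
open import Data.Nat.Primality using (prime[2]; euclidsLemma)
open import Relation.Binary.PropositionalEquality using (_≡_; sym; trans; cong; subst)
open import Relation.Nullary.Negation using (contradiction)
open import Defs
open Ramanujan

mainTheorem13 : (n d j : ℕ) → 0 < n → 2 ∣ n → d ∣ n → j < n → 2 ∣ j →
    ((n div d) % 2 ≡ 1 → c j (n div d) ≡ c (j div 2) ((n div 2) div (d div 2)))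
    × ((n div d) % 4 ≡ 2 → c j (n div d) ≡ c (j div 2) ((n div 2) div d))
    × (4 ∣ (n div d) → c j (n div d) ≡ + 2 * c (j div 2) ((n div 2) div d))
mainTheorem13 n d j _ 2∣n d∣n _ 2∣j =
    (λ q%2≡1 → trans (c[j,q]≡c[j/2,q] (n div d) 2∣j q%2≡1)
                     (cong (c (j div 2)) (sym (m-div-k-div-[n-div-k]≡m-div-n n (2∣d q%2≡1)))))
  , (λ q%4≡2 → trans (c[j,q]≡c[j/2,q/2] (n div d) 2∣j q%4≡2) (cong (c (j div 2)) n/d/2≡n/2/d))
  , (λ 4∣q → trans (c[j,q]≡2*c[j/2,q/2] (n div d) 2∣j 4∣q) (cong (λ i → + 2 * c (j div 2) i) n/d/2≡n/2/d))
  where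
  n/d/2≡n/2/d : (n div d) div 2 ≡ (n div 2) div d
  n/d/2≡n/2/d = m-div-n-div-o≡m-div-o-div-n n d 2

  2∣d : (n div d) % 2 ≡ 1 → 2 ∣ d
  2∣d q%2≡1 with euclidsLemma (n div d) d prime[2] (subst (2 ∣_) (sym (m-div-n*n≡m d∣n)) 2∣n)
  ... | inj₁ 2∣q = contradiction 2∣q (m%2≡1⇒¬2∣m (n div d) q%2≡1)
  ... | inj₂ 2∣d = 2∣d
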